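{- Let $G$ be a tree, let $r\ge1$, and let $\mathcal{H}$ be a $c'$-minor of $\mathcal{C}_r(G)$ with $|E(\mathcal{H})|\ge3$. Let $V_1,V_2,\dots$ be the simplicial layers of $G$ and $\ell=\min\{i: V_i\cap V(\mathcal{H})\ne\emptyset\}$, and assume $\ell\ne1$. Then there exists a cut vertex $v$ of $G$ such that $v\in V(\mathcal{H})$ and $V(\mathcal{H})\setminus\{v\}\subseteq V(G_1)$ for some connected component $G_1$ of $G\setminus\{v\}$.
   Context: A vertex of a graph is simplicial if its neighbors are pairwise adjacent. Simplicial layers: $V_1$ is the set of simplicial vertices of $G$, and for $i\ge2$, $V_i$ is the set of simplicial vertices of the induced subgraph $G\setminus(V_1\cup\dots\cup V_{i-1})$. A cut vertex is a vertex whose removal increases the number of connected components. A hypergraph consists of a vertex set and subsets (edges), none contained in another. $\mathcal{C}_r(G)$ is the hypergraph on $V(G)$ whose edges are all $S\subseteq V(G)$ with $|S|=r+1$ and $G[S]$ connected. Contraction $\mathcal{H}/v$: vertex set $V(\mathcal{H})\setminus\{v\}$, edges the inclusion-minimal members of $\{e\setminus\{v\}: e\in E(\mathcal{H})\}$. A $c$-minor is a hypergraph obtained by contracting a set of vertices (no deletions); a $c'$-minor is a $c$-minor with no singleton edges. -}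

module Defs where

open import Level using (0ℓ)
open import Data.Nat using (ℕ; zero; suc; _+_; _≤_; _<_)
open import Data.Fin using (Fin; zero; suc; inject₁; fromℕ)
open import Data.Fin.Subset using (Subset; _∈_; _∉_; _⊆_; _-_; ∣_∣)
open import Data.List using (List; []; _∷_)
open import Data.Product using (Σ; ∃; _×_; _,_)
open import Data.Unit using (⊤)
open import Data.Empty using (⊥)
open import Function.Definitions using (Injective)
open import Relation.Nullary using (¬_)
open import Relation.Binary.PropositionalEquality using (_≡_; _≢_)

record Graph (n : ℕ) : Set₁ where
  field
    _~_    : Fin n → Fin n → Set
    sym    : ∀ {u v} → u ~ v → v ~ u
    irrefl : ∀ {u} → ¬ (u ~ u)
open Graph public

VSet : ℕ → Set₁
VSet n = Fin n → Set

data Walk {n} (G : Graph n) (P : VSet n) : Fin n → Fin n → Set where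
  nil  : ∀ {u} → P u → Walk G P u u
  cons : ∀ {u w v} → P u → _~_ G u w → Walk G P w v → Walk G P u v

ConnectedOn : ∀ {n} → Graph n → VSet n → Set
ConnectedOn G P = ∀ u v → P u → P v → Walk G P u v

AllV : ∀ {n} → VSet n
AllV _ = ⊤

AllBut : ∀ {n} → Fin n → VSet n
AllBut x u = u ≢ x

Cycle : ∀ {n} → Graph n → Set
Cycle {n} G = Σ ℕ λ k → Σ (Fin (3 + k) → Fin n) λ f →
  Injective _≡_ _≡_ f
  × (∀ (i : Fin (2 + k)) → _~_ G (f (inject₁ i)) (f (suc i)))
  × _~_ G (f (fromℕ (2 + k))) (f zero)

-- A tree: a nonempty connected acyclic graph.
IsTree : ∀ {n} → Graph n → Set
IsTree {n} G = Fin n × ConnectedOn G AllV × ¬ Cycle G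

HasComponents : ∀ {n} → Graph n → VSet n → ℕ → Set
HasComponents {n} G P k = Σ (Fin k → Fin n) λ rep →
  (∀ i → P (rep i))
  × (∀ i j → Walk G P (rep i) (rep j) → i ≡ j)
  × (∀ u → P u → Σ (Fin k) λ i → Walk G P (rep i) u)

CutVertex : ∀ {n} → Graph n → Fin n → Set
CutVertex G v = Σ ℕ λ k → Σ ℕ λ k' →
  HasComponents G AllV k × HasComponents G (AllBut v) k' × k < k'

Simplicial : ∀ {n} → Graph n → VSet n → Fin n → Set
Simplicial G P v = P v × (∀ u w → P u → P w → _~_ G u v → _~_ G w v → u ≢ w → _~_ G u w)

Rem : ∀ {n} → Graph n → ℕ → VSet n
Rem G zero    v = ⊤
Rem G (suc i) v = Rem G i v × ¬ Simplicial G (Rem G i) v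

-- Simplicial layers, 1-indexed: Layer G (suc i) = V_{i+1}; Layer G 0 is empty.
Layer : ∀ {n} → Graph n → ℕ → VSet n
Layer G zero    v = ⊥
Layer G (suc i) v = Simplicial G (Rem G i) v

record Hypergraph (n : ℕ) : Set₁ where
  field
    verts : Subset n
    edges : Subset n → Set
open Hypergraph public

C : ∀ {n} → ℕ → Graph n → Hypergraph n
verts (C r G) = Data.Fin.Subset.⊤
edges (C r G) S = ∣ S ∣ ≡ suc r × ConnectedOn G (_∈ S)

-- Contraction H / v: edges are the inclusion-minimal members of {e ∖ {v}}.
contract : ∀ {n} → Hypergraph n → Fin n → Hypergraph n
verts (contract H v) = verts H - v
edges (contract H v) e' =
  (Σ (Subset _) λ e → edges H e × e' ≡ e - v)
  × (∀ e → edges H e → (e - v) ⊆ e' → (e - v) ≡ e')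

contractAll : ∀ {n} → Hypergraph n → List (Fin n) → Hypergraph n
contractAll H []       = H
contractAll H (v ∷ vs) = contractAll (contract H v) vs

-- H is a c'-minor: no singleton edges.
NoSingletonEdges : ∀ {n} → Hypergraph n → Set
NoSingletonEdges H = ∀ e → edges H e → ∣ e ∣ ≢ 1

AtLeast3Edges : ∀ {n} → Hypergraph n → Set
AtLeast3Edges {n} H = Σ (Subset n) λ a → Σ (Subset n) λ b → Σ (Subset n) λ c →
  edges H a × edges H b × edges H c × a ≢ b × a ≢ c × b ≢ c

IsMinLayer : ∀ {n} → Graph n → Hypergraph n → ℕ → Set
IsMinLayer G H ℓ =
  (∃ λ v → Layer G ℓ v × v ∈ verts H)
  × (∀ i → (∃ λ v → Layer G i v × v ∈ verts H) → ℓ ≤ i)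

-- Since ℓ ≠ 1, no vertex of V(H) lies in V₁, i.e. none is a leaf of the tree G.
-- For v ∈ V(G), every z ≠ v reaches v through a neighbour branch v z, and this
-- neighbour is constant on each component of G − v (two neighbours of v joined
-- in G − v would close a cycle); so the components of G − v correspond to the
-- neighbours of v, and a non-leaf is a cut vertex. For one-sidedness, let
-- side(a, b) be the component of G − a containing b. If a, b ∈ V(H) and some
-- c ∈ V(H) lies in another component of G − b than a, then side(b, c) is a
-- proper subset of side(a, b). Moving from (a, b) to (b, c) therefore stops, at
-- a vertex b such that V(H) ∖ {b} lies in the component of G − b containing a.
module Submission where

open import Defs hiding (_~_; sym; irrefl)
open import Data.Nat using (ℕ; _≤_)
open import Data.Fin using (Fin)
open import Data.Fin.Subset using (_∈_)
open import Data.List using (List)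
open import Data.Product using (Σ; _×_)
open import Relation.Binary.PropositionalEquality using (_≢_)

open import Function using (_∘_)
open import Data.Empty using (⊥-elim)
open import Data.Unit using (⊤; tt)
open import Data.Sum using (_⊎_; inj₁; inj₂)
open import Data.Product using (_,_; proj₁; proj₂)
open import Data.Nat using (zero; suc; _+_; _<_; z≤n; s≤s)
open import Data.Nat.Properties using (≤-refl; ≤-antisym; _<?_; ≮⇒≥)
open import Data.Nat.Induction using (<-wellFounded)
open import Induction.WellFounded using (Acc; acc)
open import Data.Fin using (zero; suc; inject₁; fromℕ; _≟_)
open import Data.Fin.Properties using (any?)
open import Data.Fin.Subset using (Subset; _⊂_; ∣_∣)
open import Data.Fin.Subset.Properties using (_∈?_; p⊂q⇒∣p∣<∣q∣)
open import Data.Vec using (tabulate)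
open import Data.Vec.Properties using (lookup∘tabulate; lookup⇒[]=; []=⇒lookup)
open import Data.List using (_∷_; length; filter; allFin; lookup)
open import Data.List.Relation.Unary.All as All using ()
open import Data.List.Relation.Unary.AllPairs using (_∷_)
open import Data.List.Relation.Unary.Any using (index)
open import Data.List.Relation.Unary.Any.Properties using (lookup-index)
open import Data.List.Relation.Unary.Unique.Propositional using (Unique)
open import Data.List.Relation.Unary.Unique.Propositional.Properties using (allFin⁺; filter⁺)
open import Data.List.Membership.Propositional.Properties using (∈-filter⁺; ∈-filter⁻; ∈-lookup; ∈-allFin)
open import Relation.Nullary using (¬_; yes; no; ¬?; _×-dec_)
open import Relation.Nullary.Decidable using (does; dec-true; decidable-stable)
open import Relation.Unary using (Decidable)
open import Relation.Binary.PropositionalEquality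
  using (_≡_; refl; sym; trans; cong; subst; ≢-sym; module ≡-Reasoning)

Fin≤1-irrelevant : ∀ {k} → k ≤ 1 → (i j : Fin k) → i ≡ j
Fin≤1-irrelevant (s≤s z≤n) zero zero = refl

Unique⇒lookup-injective : ∀ {m} {xs : List (Fin m)} → Unique xs →
  ∀ {i j} → lookup xs i ≡ lookup xs j → i ≡ j
Unique⇒lookup-injective (_ ∷ _)  {zero}  {zero}  _  = refl
Unique⇒lookup-injective (x∉ ∷ _) {zero}  {suc j} eq = ⊥-elim (All.lookup x∉ (∈-lookup j) eq)
Unique⇒lookup-injective (x∉ ∷ _) {suc i} {zero}  eq = ⊥-elim (All.lookup x∉ (∈-lookup i) (sym eq))
Unique⇒lookup-injective (_ ∷ u)  {suc i} {suc j} eq = cong suc (Unique⇒lookup-injective u eq)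

module _ {n : ℕ} {P : Fin n → Set} (P? : Decidable P) where

  toSubset : Subset n
  toSubset = tabulate (does ∘ P?)

  ∈-toSubset⁺ : ∀ {x} → P x → x ∈ toSubset
  ∈-toSubset⁺ {x} px = lookup⇒[]= x _ (trans (lookup∘tabulate _ x) (dec-true (P? x) px))

  ∈-toSubset⁻ : ∀ {x} → x ∈ toSubset → P x
  ∈-toSubset⁻ {x} x∈ with P? x | trans (sym (lookup∘tabulate _ x)) ([]=⇒lookup x∈)
  ... | yes px | _ = px
  ... | no _   | ()

layer⇒index-positive : ∀ {n} {G : Graph n} ℓ {v} → Layer G ℓ v → 1 ≤ ℓ
layer⇒index-positive (suc _) _ = s≤s z≤n

-- V₁ is the set of simplicial vertices of G itself, as Rem G 0 is AllV.
minLayer≢1⇒¬simplicial : ∀ {n} {G : Graph n} {H : Hypergraph n} {ℓ} →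
  IsMinLayer G H ℓ → ℓ ≢ 1 → ∀ {v} → v ∈ verts H → ¬ Simplicial G AllV v
minLayer≢1⇒¬simplicial {ℓ = ℓ} ((_ , w∈Vℓ , _) , minimal) ℓ≢1 v∈H simp =
  ℓ≢1 (≤-antisym (minimal 1 (_ , simp , v∈H)) (layer⇒index-positive ℓ w∈Vℓ))

module _ {n} (G : Graph n) where

  open Graph G using (_~_) renaming (sym to ~-sym; irrefl to ~-irrefl)

  ~⇒≢ : ∀ {u v} → u ~ v → u ≢ v
  ~⇒≢ u~v refl = ~-irrefl u~v

  ¬simplicial⇒other-vertex : ∀ {v} → ¬ Simplicial G AllV v → Σ (Fin n) (_≢ v)
  ¬simplicial⇒other-vertex {v} ¬simp with any? (λ t → ¬? (t ≟ v))
  ... | yes other = other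
  ... | no ∄other =
    ⊥-elim (¬simp (tt , λ u w _ _ _ _ u≢w → ⊥-elim (u≢w (trans (≡v u) (sym (≡v w))))))
    where
      ≡v : ∀ t → t ≡ v
      ≡v t = decidable-stable (t ≟ v) (λ t≢v → ∄other (t , t≢v))

  connected⇒one-component : Fin n → ConnectedOn G AllV → HasComponents G AllV 1
  connected⇒one-component v conn =
    (λ _ → v) , (λ _ → tt) , (λ i j _ → Fin≤1-irrelevant ≤-refl i j) ,
    (λ u _ → zero , conn v u tt tt)

  walk-head : ∀ {P a b} → Walk G P a b → P a
  walk-head (nil p)      = p
  walk-head (cons p _ _) = p

  walk-last : ∀ {P a b} → Walk G P a b → P b
  walk-last (nil p)      = p
  walk-last (cons _ _ r) = walk-last r

  _++ʷ_ : ∀ {P a b c} → Walk G P a b → Walk G P b c → Walk G P a c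
  nil _      ++ʷ w = w
  cons p e r ++ʷ w = cons p e (r ++ʷ w)

  snocʷ : ∀ {P a b c} → Walk G P a b → b ~ c → P c → Walk G P a c
  snocʷ r e pc = r ++ʷ cons (walk-last r) e (nil pc)

  reverseʷ : ∀ {P a b} → Walk G P a b → Walk G P b a
  reverseʷ (nil p)      = nil p
  reverseʷ (cons p e r) = snocʷ (reverseʷ r) (~-sym e) p

  weakenʷ : ∀ {P Q : VSet n} {a b} → (∀ {z} → P z → Q z) → Walk G P a b → Walk G Q a b
  weakenʷ f (nil p)      = nil (f p)
  weakenʷ f (cons p e r) = cons (f p) e (weakenʷ f r)

  avoid-or-reach : ∀ {P a b} x → Walk G P a b → Walk G (λ t → P t × t ≢ x) a b ⊎ Walk G P a x
  avoid-or-reach x (nil {u} p) with u ≟ x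
  ... | yes refl = inj₂ (nil p)
  ... | no u≢x   = inj₁ (nil (p , u≢x))
  avoid-or-reach x (cons {u} p e r) with u ≟ x
  ... | yes refl = inj₂ (nil p)
  ... | no u≢x with avoid-or-reach x r
  ...   | inj₁ r′ = inj₁ (cons (p , u≢x) e r′)
  ...   | inj₂ r′ = inj₂ (cons p e r′)

  walk-exit : ∀ {P a v} → Walk G P a v → a ≢ v → Σ (Fin n) λ x → x ~ v × Walk G (AllBut v) a x
  walk-exit (nil _) a≢v = ⊥-elim (a≢v refl)
  walk-exit {v = v} (cons {u} {w} _ e r) u≢v with w ≟ v
  ... | yes refl = u , e , nil u≢v
  ... | no w≢v with walk-exit r w≢v
  ...   | x , x~v , r′ = x , x~v , cons u≢v e r′

  steps : ∀ {P a b} → Walk G P a b → ℕ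
  steps (nil _)      = 0
  steps (cons _ _ r) = suc (steps r)

  vertexAt : ∀ {P a b} (w : Walk G P a b) → Fin (suc (steps w)) → Fin n
  vertexAt {a = a} _   zero    = a
  vertexAt (nil _)     (suc ())
  vertexAt (cons _ _ r) (suc i) = vertexAt r i

  vertexAt-adjacent : ∀ {P a b} (w : Walk G P a b) (i : Fin (steps w)) →
    vertexAt w (inject₁ i) ~ vertexAt w (suc i)
  vertexAt-adjacent (cons _ e _) zero    = e
  vertexAt-adjacent (cons _ _ r) (suc i) = vertexAt-adjacent r i

  vertexAt-last : ∀ {P a b} (w : Walk G P a b) → vertexAt w (fromℕ (steps w)) ≡ b
  vertexAt-last (nil _)      = refl
  vertexAt-last (cons _ _ r) = vertexAt-last r

  vertexAt-inside : ∀ {P a b} (w : Walk G P a b) i → P (vertexAt w i)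
  vertexAt-inside w            zero    = walk-head w
  vertexAt-inside (cons _ _ r) (suc i) = vertexAt-inside r i

  IsPath : ∀ {P a b} → Walk G P a b → Set
  IsPath (nil _)          = ⊤
  IsPath (cons {u} _ _ r) = (∀ i → vertexAt r i ≢ u) × IsPath r

  vertexAt-injective : ∀ {P a b} (w : Walk G P a b) → IsPath w →
    ∀ {i j} → vertexAt w i ≡ vertexAt w j → i ≡ j
  vertexAt-injective _            _          {zero}  {zero}  _  = refl
  vertexAt-injective (cons _ _ r) (new , _)  {zero}  {suc j} eq = ⊥-elim (new j (sym eq))
  vertexAt-injective (cons _ _ r) (new , _)  {suc i} {zero}  eq = ⊥-elim (new i eq)
  vertexAt-injective (cons _ _ r) (_ , path) {suc i} {suc j} eq =
    cong suc (vertexAt-injective r path eq)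

  dropʷ : ∀ {P a b} (w : Walk G P a b) → IsPath w → (i : Fin (suc (steps w))) →
    Σ (Walk G P (vertexAt w i) b) IsPath
  dropʷ w            path       zero    = w , path
  dropʷ (nil _)      _          (suc ())
  dropʷ (cons _ _ r) (_ , path) (suc i) = dropʷ r path i

  toPath : ∀ {P a b} → Walk G P a b → Σ (Walk G P a b) IsPath
  toPath (nil p) = nil p , tt
  toPath (cons {u} p e r) with toPath r
  ... | r′ , path with any? (λ i → vertexAt r′ i ≟ u)
  ...   | yes (i , eq) = subst (λ t → Σ (Walk G _ t _) IsPath) eq (dropʷ r′ path i)
  ...   | no ∄revisit  = cons p e r′ , (λ i eq → ∄revisit (i , eq)) , path

  acyclic⇒neighbours-separated : ¬ Cycle G → ∀ {v x y} → x ~ v → y ~ v → x ≢ y →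
    ¬ Walk G (AllBut v) x y
  acyclic⇒neighbours-separated acyc {v} x~v y~v x≢y w with toPath w
  ... | nil _ , _ = x≢y refl
  ... | s@(cons _ _ r) , path = acyc (steps r , cycle , injective , adjacent , closing)
    where
      cycle : Fin (3 + steps r) → Fin n
      cycle zero    = v
      cycle (suc i) = vertexAt s i

      injective : ∀ {i j} → cycle i ≡ cycle j → i ≡ j
      injective {zero}  {zero}  _  = refl
      injective {zero}  {suc j} eq = ⊥-elim (vertexAt-inside s j (sym eq))
      injective {suc i} {zero}  eq = ⊥-elim (vertexAt-inside s i eq)
      injective {suc i} {suc j} eq = cong suc (vertexAt-injective s path eq)

      adjacent : ∀ (i : Fin (2 + steps r)) → cycle (inject₁ i) ~ cycle (suc i)
      adjacent zero    = ~-sym x~v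
      adjacent (suc i) = vertexAt-adjacent s i

      closing : cycle (fromℕ (2 + steps r)) ~ v
      closing = subst (_~ v) (sym (vertexAt-last s)) y~v

  OneSided : VSet n → Fin n → Set
  OneSided S v = Σ (Fin n) λ u → u ≢ v × (∀ w → S w → w ≢ v → Walk G (AllBut v) u w)

  module Tree (conn : ConnectedOn G AllV) (acyc : ¬ Cycle G) where

    -- The neighbour of v through which z reaches v; junk value branch v v = v.
    branch : Fin n → Fin n → Fin n
    branch v z with z ≟ v
    ... | yes _   = z
    ... | no z≢v  = proj₁ (walk-exit (conn z v tt tt) z≢v)

    branch-spec : ∀ {v z} → z ≢ v → branch v z ~ v × Walk G (AllBut v) z (branch v z)
    branch-spec {v} {z} z≢v with z ≟ v
    ... | yes z≡v = ⊥-elim (z≢v z≡v)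
    ... | no z≢v′ = proj₂ (walk-exit (conn z v tt tt) z≢v′)

    branch-walk : ∀ {v z} → z ≢ v → Walk G (AllBut v) z (branch v z)
    branch-walk z≢v = proj₂ (branch-spec z≢v)

    branch-≢ : ∀ {v z} → z ≢ v → branch v z ≢ v
    branch-≢ z≢v = ~⇒≢ (proj₁ (branch-spec z≢v))

    walk⇒branch-≡ : ∀ {v a b} → Walk G (AllBut v) a b → branch v a ≡ branch v b
    walk⇒branch-≡ {v} {a} {b} w with branch v a ≟ branch v b
    ... | yes eq = eq
    ... | no ne  = ⊥-elim (acyclic⇒neighbours-separated acyc
                    (proj₁ (branch-spec a≢v)) (proj₁ (branch-spec b≢v)) ne
                    (reverseʷ (branch-walk a≢v) ++ʷ (w ++ʷ branch-walk b≢v)))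
      where
        a≢v = walk-head w
        b≢v = walk-last w

    branch-idempotent : ∀ {v z} → z ≢ v → branch v (branch v z) ≡ branch v z
    branch-idempotent z≢v = sym (walk⇒branch-≡ (branch-walk z≢v))

    branch-neighbour : ∀ {v p} → p ~ v → branch v p ≡ p
    branch-neighbour {v} {p} p~v with branch v p ≟ p
    ... | yes eq = eq
    ... | no ne  = ⊥-elim (acyclic⇒neighbours-separated acyc p~v (proj₁ (branch-spec p≢v))
                    (ne ∘ sym) (branch-walk p≢v))
      where p≢v = ~⇒≢ p~v

    -- A decidable substitute for z ~ v (the two are equivalent, but _~_ is not decidable).
    IsBranchRoot : Fin n → Fin n → Set
    IsBranchRoot v z = z ≢ v × branch v z ≡ z

    neighbour⇒branchRoot : ∀ {v p} → p ~ v → IsBranchRoot v p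
    neighbour⇒branchRoot p~v = ~⇒≢ p~v , branch-neighbour p~v

    module Components (v : Fin n) where

      isBranchRoot? : Decidable (IsBranchRoot v)
      isBranchRoot? z = ¬? (z ≟ v) ×-dec (branch v z ≟ z)

      roots : List (Fin n)
      roots = filter isBranchRoot? (allFin n)

      root : Fin (length roots) → Fin n
      root = lookup roots

      root-isBranchRoot : ∀ i → IsBranchRoot v (root i)
      root-isBranchRoot i = proj₂ (∈-filter⁻ isBranchRoot? {xs = allFin n} (∈-lookup i))

      rootIndex : ∀ {z} → IsBranchRoot v z → Fin (length roots)
      rootIndex {z} r = index (∈-filter⁺ isBranchRoot? (∈-allFin z) r)

      root-rootIndex : ∀ {z} (r : IsBranchRoot v z) → z ≡ root (rootIndex r)
      root-rootIndex {z} r = lookup-index (∈-filter⁺ isBranchRoot? (∈-allFin z) r)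

      components-AllBut : HasComponents G (AllBut v) (length roots)
      components-AllBut = root , (proj₁ ∘ root-isBranchRoot) , separated , covered
        where
          separated : ∀ i j → Walk G (AllBut v) (root i) (root j) → i ≡ j
          separated i j w = Unique⇒lookup-injective (filter⁺ isBranchRoot? (allFin⁺ n))
            (trans (sym (proj₂ (root-isBranchRoot i)))
              (trans (walk⇒branch-≡ w) (proj₂ (root-isBranchRoot j))))

          covered : ∀ u → u ≢ v → Σ (Fin (length roots)) λ i → Walk G (AllBut v) (root i) u
          covered u u≢v = rootIndex r , subst (λ t → Walk G (AllBut v) t u) (root-rootIndex r)
                                              (reverseʷ (branch-walk u≢v))
            where r = branch-≢ u≢v , branch-idempotent u≢v

    open Components using (roots; rootIndex; root-rootIndex; components-AllBut)

    ¬simplicial⇒cut-vertex : ∀ {v} → ¬ Simplicial G AllV v → CutVertex G v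
    ¬simplicial⇒cut-vertex {v} ¬simp with 1 <? length (roots v)
    ... | yes 1<k = 1 , length (roots v) , connected⇒one-component v conn , components-AllBut v , 1<k
    ... | no 1≮k  = ⊥-elim (¬simp (tt , λ u w _ _ u~v w~v u≢w → ⊥-elim (u≢w (same u~v w~v))))
      where
        same : ∀ {u w} → u ~ v → w ~ v → u ≡ w
        same u~v w~v = begin
          _ ≡⟨ root-rootIndex v (neighbour⇒branchRoot u~v) ⟩
          lookup (roots v) (rootIndex v (neighbour⇒branchRoot u~v))
            ≡⟨ cong (lookup (roots v)) (Fin≤1-irrelevant (≮⇒≥ 1≮k) _ _) ⟩
          lookup (roots v) (rootIndex v (neighbour⇒branchRoot w~v))
            ≡⟨ sym (root-rootIndex v (neighbour⇒branchRoot w~v)) ⟩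
          _ ∎
          where open ≡-Reasoning

    Side : Fin n → Fin n → Fin n → Set
    Side a b z = z ≢ a × branch a z ≡ branch a b

    side? : ∀ a b → Decidable (Side a b)
    side? a b z = ¬? (z ≟ a) ×-dec (branch a z ≟ branch a b)

    side : Fin n → Fin n → Subset n
    side a b = toSubset (side? a b)

    Side-⊆ : ∀ {a b c} → a ≢ b → branch b c ≢ branch b a → ∀ {z} → Side b c z → Side a b z
    Side-⊆ {a} {b} a≢b far {z} (z≢b , z-side) = z≢a , walk⇒branch-≡ z⇝b
      where
        z≢a : z ≢ a
        z≢a refl = far (sym z-side)

        z⇝b : Walk G (AllBut a) z b
        z⇝b with avoid-or-reach a (branch-walk z≢b)
        ... | inj₂ z⇝a = ⊥-elim (far (trans (sym z-side) (walk⇒branch-≡ z⇝a)))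
        ... | inj₁ r   = snocʷ (weakenʷ proj₂ r) (proj₁ (branch-spec z≢b)) (≢-sym a≢b)

    side-shrinks : ∀ {a b c} → a ≢ b → branch b c ≢ branch b a → side b c ⊂ side a b
    side-shrinks {a} {b} {c} a≢b far =
      (∈-toSubset⁺ (side? a b) ∘ Side-⊆ {c = c} a≢b far ∘ ∈-toSubset⁻ (side? b c)) ,
      b , ∈-toSubset⁺ (side? a b) (≢-sym a≢b , refl) ,
      (λ b∈ → proj₁ (∈-toSubset⁻ (side? b c) b∈) refl)

    module Extremal {S : VSet n} (S? : Decidable S) where

      extremal-from : ∀ {a b} → S a → S b → a ≢ b → Acc _<_ ∣ side a b ∣ →
        Σ (Fin n) λ v → S v × OneSided S v
      extremal-from {a} {b} _ sb a≢b (acc smaller)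
        with any? (λ c → S? c ×-dec ¬? (c ≟ b) ×-dec ¬? (branch b c ≟ branch b a))
      ... | yes (c , sc , c≢b , far) =
            extremal-from sb sc (≢-sym c≢b) (smaller (p⊂q⇒∣p∣<∣q∣ (side-shrinks {c = c} a≢b far)))
      ... | no ∄far = b , sb , branch b a , branch-≢ a≢b , near
        where
          near : ∀ w → S w → w ≢ b → Walk G (AllBut b) (branch b a) w
          near w sw w≢b = subst (λ t → Walk G (AllBut b) t w)
            (decidable-stable (_ ≟ _) (λ ne → ∄far (w , sw , w≢b , ne)))
            (reverseʷ (branch-walk w≢b))

      extremal : ∀ {s t} → S s → t ≢ s → Σ (Fin n) λ v → S v × OneSided S v
      extremal {s} {t} ss t≢s with any? (λ b → S? b ×-dec ¬? (b ≟ s))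
      ... | yes (b , sb , b≢s) = extremal-from ss sb (≢-sym b≢s) (<-wellFounded _)
      ... | no ∄other = s , ss , t , t≢s , λ w sw w≢s → ⊥-elim (∄other (w , sw , w≢s))

    one-sided-cut-vertex : ∀ {S : VSet n} → Decidable S → (∀ {v} → S v → ¬ Simplicial G AllV v) →
      ∀ {s} → S s → Σ (Fin n) λ v → CutVertex G v × S v × OneSided S v
    one-sided-cut-vertex S? ¬simplicial ss
      with Extremal.extremal S? ss (proj₂ (¬simplicial⇒other-vertex (¬simplicial ss)))
    ... | v , sv , oneSided = v , ¬simplicial⇒cut-vertex (¬simplicial sv) , sv , oneSided

lemma4p5 : ∀ {n} (G : Graph n) (r : ℕ) (vs : List (Fin n)) (ℓ : ℕ) →
    IsTree G → 1 ≤ r →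
    NoSingletonEdges (contractAll (C r G) vs) →
    AtLeast3Edges (contractAll (C r G) vs) →
    IsMinLayer G (contractAll (C r G) vs) ℓ → ℓ ≢ 1 →
    Σ (Fin n) λ v → CutVertex G v × v ∈ verts (contractAll (C r G) vs)
      × Σ (Fin n) λ u → (u ≢ v) ×
        (∀ w → w ∈ verts (contractAll (C r G) vs) → w ≢ v → Walk G (AllBut v) u w)
lemma4p5 G r vs ℓ (_ , conn , acyc) _ _ _ minLayer@((_ , _ , s∈H) , _) ℓ≢1 =
  Tree.one-sided-cut-vertex G conn acyc (_∈? verts H)
    (minLayer≢1⇒¬simplicial {H = H} minLayer ℓ≢1) s∈H
  where H = contractAll (C r G) vs
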